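{- Let $\mathcal{Z}$ be a zero-set and let $(\vec r,\vec c)$ be enhancements that span for $\mathcal{Z}$, and let $A_t=\mathcal{T}_{\mathrm{en}}^t(\emptyset)$. Then for all $t\ge0$: (1) $A_t$ is a Young diagram; (2) for any $i,j\ge0$, if $(i-1,j)\in\overline{A_t}$ and $(i,j-1)\in\overline{A_t}$, then $(i,j)\in A_{t+1}$; (3) if $c_i=c_{i'}$ and $r_j=r_{j'}$, then $(i,j)\in A_t$ if and only if $(i',j')\in A_t$.
   Context: $\mathbb{Z}_+=\{0,1,2,\dots\}$, $\mathbb{N}=\{1,2,\dots\}$. For $a,b\in\mathbb{N}$, $R_{a,b}=([0,a-1]\times[0,b-1])\cap\mathbb{Z}_+^2$; a zero-set is a union of $R_{a,b}$ over a finite $\mathcal{I}\subseteq\mathbb{N}^2$ (possibly empty). $(i,j)\preceq(i',j')$ iff $i\le i'$, $j\le j'$; a Young diagram is a $\preceq$-downward closed subset of $\mathbb{Z}_+^2$. For $X\subseteq\mathbb{Z}_+^2$, its closure is $\overline{X}=X\cup(\mathbb{Z}^2\setminus\mathbb{Z}_+^2)$. For $x\in\mathbb{Z}_+^2$ and $A\subseteq\mathbb{Z}_+^2$, $\mathtt{row}(x,A)$ and $\mathtt{col}(x,A)$ are the numbers of points of $A$ on the horizontal and vertical line through $x$. Enhancements $\vec r=(r_0,r_1,\dots)$, $\vec c=(c_0,c_1,\dots)$ are weakly decreasing sequences of nonnegative integers; $\mathcal{T}_{\mathrm{en}}(A)=A\cup\{(i,j)\in\mathbb{Z}_+^2:(\mathtt{row}((i,j),A)+r_j,\mathtt{col}((i,j),A)+c_i)\notin\mathcal{Z}\}$;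 $(\vec r,\vec c)$ spans for $\mathcal{Z}$ if $\bigcup_{t\ge0}\mathcal{T}_{\mathrm{en}}^t(\emptyset)=\mathbb{Z}_+^2$. -}

module Defs where

open import Data.Nat using (ℕ; zero; suc; _≤_; _<_; _∸_)
open import Data.Fin using (Fin)
open import Data.Product using (Σ; _×_; _,_)
open import Data.Sum using (_⊎_)
open import Data.Empty using (⊥)
open import Data.Unit using (⊤)
open import Data.List using (List)
open import Data.List.Relation.Unary.All using (All)
open import Data.List.Relation.Unary.Any using (Any)
open import Relation.Nullary using (¬_)
open import Relation.Binary.PropositionalEquality using (_≡_)
open import Function.Definitions using (Injective)

Subset² : Set₁
Subset² = ℕ → ℕ → Set

-- A zero-set is given by a finite index list 𝓘 ⊆ ℕ² (positive entries);
-- 𝒵 = ⋃_{(a,b) ∈ 𝓘} R_{a,b},  R_{a,b} = [0,a-1] × [0,b-1].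
IsIndexSet : List (ℕ × ℕ) → Set
IsIndexSet I = All (λ ab → 1 ≤ Data.Product.proj₁ ab × 1 ≤ Data.Product.proj₂ ab) I

InZ : List (ℕ × ℕ) → ℕ → ℕ → Set
InZ I u v = Any (λ ab → u < Data.Product.proj₁ ab × v < Data.Product.proj₂ ab) I

AtLeast : ℕ → (ℕ → Set) → Set
AtLeast k P = Σ (Fin k → ℕ) (λ f → Injective _≡_ _≡_ f × (∀ x → P (f x)))

-- "(|P| + r , |Q| + s) ∈ 𝒵" where |P|,|Q| ∈ ℕ ∪ {∞} are the cardinalities of P,Q.
-- Since |P| + r < a  ⇔  ¬ (|P| ≥ a ∸ r)  (also when r ≥ a or |P| = ∞).
InZCount : List (ℕ × ℕ) → (ℕ → Set) → ℕ → (ℕ → Set) → ℕ → Set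
InZCount I P r Q s =
  Any (λ ab → ¬ AtLeast (Data.Product.proj₁ ab ∸ r) P
            × ¬ AtLeast (Data.Product.proj₂ ab ∸ s) Q) I

Enhancement : (ℕ → ℕ) → Set
Enhancement r = ∀ m n → m ≤ n → r n ≤ r m

RowSet : Subset² → ℕ → ℕ → (ℕ → Set)
RowSet A i j = λ i' → A i' j

ColSet : Subset² → ℕ → ℕ → (ℕ → Set)
ColSet A i j = λ j' → A i j'

Ten : List (ℕ × ℕ) → (ℕ → ℕ) → (ℕ → ℕ) → Subset² → Subset²
Ten I r c A i j = A i j ⊎ ¬ InZCount I (RowSet A i j) (r j) (ColSet A i j) (c i)

Aₜ : List (ℕ × ℕ) → (ℕ → ℕ) → (ℕ → ℕ) → ℕ → Subset²
Aₜ I r c zero    i j = ⊥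
Aₜ I r c (suc t) i j = Ten I r c (Aₜ I r c t) i j

Spans : List (ℕ × ℕ) → (ℕ → ℕ) → (ℕ → ℕ) → Set
Spans I r c = ∀ i j → Σ ℕ (λ t → Aₜ I r c t i j)

YoungDiagram : Subset² → Set
YoungDiagram A = ∀ i j i' j' → i ≤ i' → j ≤ j' → A i' j' → A i j

LeftInClosure : Subset² → ℕ → ℕ → Set
LeftInClosure A zero    j = ⊤
LeftInClosure A (suc i) j = A i j

BelowInClosure : Subset² → ℕ → ℕ → Set
BelowInClosure A i zero    = ⊤
BelowInClosure A i (suc j) = A i j

module Submission where

-- Write |P| ∈ ℕ ∪ {∞} for the number of elements of a predicate
-- P on ℕ; Defs encodes "|P| ≥ n" as AtLeast n P.  A point (i,j) is added by
-- T_en exactly when (|row| + r_j, |col| + c_i) ∉ 𝒵, and 𝒵 is a down-set of ℕ².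
-- Hence everything reduces to comparing shifted counts |P| + r ≤ |Q| + s:
--   (1) Young diagram: induction on t.  Moving a point up/right shrinks its row
--       and column in A_t (induction hypothesis) and lowers r, c (enhancements
--       decrease), so the shifted counts only shrink and 𝒵 is left sooner.
--   (3) Symmetry: induction on t.  If c_i = c_i' and r_j = r_j', the induction
--       hypothesis makes the rows/columns through (i,j) and (i',j') equal.
--   (2) Closure step: if (i,j) ∉ A_t but its closed left/lower neighbours are in
--       A_t, then |row| ≥ i and |col| ≥ j in A_t, whereas in every A_u avoiding
--       (i,j) the (down-closed) row and column have at most i resp. j points.
--       So if (i,j) were not added at step t+1 it would never be added,
--       contradicting spanning.  The case split on (i,j) ∈ A_t needs A_t to be
--       decidable, which holds because all sets involved are down-closed.

open import Defs
open import Data.Nat using (ℕ; zero; suc; _≤_; _<_; _∸_; z≤n; _≤?_)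
open import Data.Nat.Properties using (∸-monoʳ-≤; ≰⇒>; ≤-reflexive; ≤-refl; 1+n≰n)
open import Data.Fin using (Fin; toℕ; inject≤; fromℕ<)
open import Data.Fin.Properties
  using (toℕ-injective; toℕ≤pred[n]; inject≤-injective; toℕ-fromℕ<; any?; injective⇒≤)
open import Data.Product using (_×_; _,_; proj₁; proj₂; ∃)
open import Data.Sum using (inj₁; inj₂)
open import Data.List using (List)
import Data.List.Relation.Unary.Any as Any
open import Function using (_∘_)
open import Relation.Nullary using (¬_; Dec; yes; no; contradiction)
open import Relation.Nullary.Decidable using (¬?; _×-dec_)
open import Relation.Unary using (Pred; _⊆_; Decidable)
open import Relation.Binary.PropositionalEquality using (_≡_; refl; sym; cong; trans)

DownClosed : Pred ℕ _ → Set
DownClosed P = ∀ {m n} → m ≤ n → P n → P m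

atLeast-zero : ∀ {P} → AtLeast 0 P
atLeast-zero = (λ ()) , (λ {x} → contradiction x λ ()) , λ ()

atLeast-≤ : ∀ {P m n} → m ≤ n → AtLeast n P → AtLeast m P
atLeast-≤ m≤n (f , f-inj , f∈P) =
  f ∘ (λ x → inject≤ x m≤n) , inject≤-injective m≤n m≤n _ _ ∘ f-inj , f∈P ∘ (λ x → inject≤ x m≤n)

atLeast-⊆ : ∀ {P Q n} → P ⊆ Q → AtLeast n P → AtLeast n Q
atLeast-⊆ P⊆Q (f , f-inj , f∈P) = f , f-inj , P⊆Q ∘ f∈P

injective-reaches : ∀ m (f : Fin (suc m) → ℕ) → (∀ {x y} → f x ≡ f y → x ≡ y) →
  ∃ λ x → m ≤ f x
injective-reaches m f f-inj with any? (λ x → m ≤? f x)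
... | yes reach = reach
... | no ¬reach = contradiction (injective⇒≤ squeeze-injective) (1+n≰n {m})
  where
  below : ∀ x → f x < m
  below x = ≰⇒> (λ m≤fx → ¬reach (x , m≤fx))

  squeeze : Fin (suc m) → Fin m
  squeeze x = fromℕ< (below x)

  squeeze-injective : ∀ {x y} → squeeze x ≡ squeeze y → x ≡ y
  squeeze-injective {x} {y} eq =
    f-inj (trans (sym (toℕ-fromℕ< (below x))) (trans (cong toℕ eq) (toℕ-fromℕ< (below y))))

atLeast-suc⇒∈ : ∀ {P m} → DownClosed P → AtLeast (suc m) P → P m
atLeast-suc⇒∈ {m = m} down (f , f-inj , f∈P) with injective-reaches m f f-inj
... | x , m≤fx = down m≤fx (f∈P x)

∈⇒atLeast-suc : ∀ {P m} → DownClosed P → P m → AtLeast (suc m) P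
∈⇒atLeast-suc down m∈P = toℕ , toℕ-injective , λ x → down (toℕ≤pred[n] x) m∈P

atLeast? : ∀ {P} → DownClosed P → Decidable P → ∀ n → Dec (AtLeast n P)
atLeast? {P} down P? zero = yes (atLeast-zero {P})
atLeast? down P? (suc m) with P? m
... | yes m∈P = yes (∈⇒atLeast-suc down m∈P)
... | no  m∉P = no (m∉P ∘ atLeast-suc⇒∈ down)

atLeast-bounded : ∀ {P i m} → DownClosed P → ¬ P i → AtLeast m P → m ≤ i
atLeast-bounded {m = zero} down i∉P _ = z≤n
atLeast-bounded {i = i} {m = suc m} down i∉P P≥m+1 with i ≤? m
... | yes i≤m = contradiction (down i≤m (atLeast-suc⇒∈ down P≥m+1)) i∉P
... | no  i≰m = ≰⇒> i≰m

-- Shifted counts:  P ⊕ r ≼ Q ⊕ s  means  |P| + r ≤ |Q| + s  in ℕ ∪ {∞}.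
-- (A record, so that P, r, Q, s can be inferred from the relation.)
record _⊕_≼_⊕_ (P : Pred ℕ _) (r : ℕ) (Q : Pred ℕ _) (s : ℕ) : Set where
  constructor dominated
  field transfer : ∀ n → AtLeast (n ∸ r) P → AtLeast (n ∸ s) Q
open _⊕_≼_⊕_

≼-mono : ∀ {P Q r s} → P ⊆ Q → r ≤ s → P ⊕ r ≼ Q ⊕ s
≼-mono {P} {Q} P⊆Q r≤s = dominated λ n → atLeast-≤ {Q} (∸-monoʳ-≤ n r≤s) ∘ atLeast-⊆ {P} {Q} P⊆Q

≼-bounded : ∀ {P Q i r} → DownClosed P → ¬ P i → AtLeast i Q → P ⊕ r ≼ Q ⊕ r
≼-bounded {P} {Q} down i∉P Q≥i = dominated λ n P≥n-r → atLeast-≤ {Q} (atLeast-bounded {P} down i∉P P≥n-r) Q≥i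

InZCount-antitone : ∀ I {P P' Q Q' r r' s s'} →
  P' ⊕ r' ≼ P ⊕ r → Q' ⊕ s' ≼ Q ⊕ s → InZCount I P r Q s → InZCount I P' r' Q' s'
InZCount-antitone I P'≼P Q'≼Q =
  Any.map λ { {a , b} (¬P , ¬Q) → ¬P ∘ transfer P'≼P a , ¬Q ∘ transfer Q'≼Q b }

module Bootstrap (I : List (ℕ × ℕ)) (r c : ℕ → ℕ) where

  A : ℕ → Subset²
  A = Aₜ I r c

  Blocked : ℕ → ℕ → ℕ → Set
  Blocked t i j = InZCount I (RowSet (A t) i j) (r j) (ColSet (A t) i j) (c i)

  blocked-antitone : ∀ {t u i j i' j'} →
    RowSet (A u) i' j' ⊕ r j' ≼ RowSet (A t) i j ⊕ r j →
    ColSet (A u) i' j' ⊕ c i' ≼ ColSet (A t) i j ⊕ c i →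
    Blocked t i j → Blocked u i' j'
  blocked-antitone = InZCount-antitone I

  -- Property (3): points whose rows and columns carry equal enhancements are
  -- added at the same time, since their rows and columns agree at every stage.
  symmetric : ∀ t i i' j j' → c i ≡ c i' → r j ≡ r j' → A t i j → A t i' j'
  symmetric zero    i i' j j' ci cj ()
  symmetric (suc t) i i' j j' ci cj (inj₁ old) = inj₁ (symmetric t i i' j j' ci cj old)
  symmetric (suc t) i i' j j' ci cj (inj₂ unblocked) = inj₂ (unblocked ∘ blocked-antitone
    (≼-mono (λ {k} → symmetric t k k j j' refl cj) (≤-reflexive cj))
    (≼-mono (λ {k} → symmetric t i i' k k ci refl) (≤-reflexive ci)))

  module _ (er : Enhancement r) (ec : Enhancement c) where

    young : ∀ t → YoungDiagram (A t)
    young zero    i j i' j' i≤i' j≤j' ()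
    young (suc t) i j i' j' i≤i' j≤j' (inj₁ old) = inj₁ (young t i j i' j' i≤i' j≤j' old)
    young (suc t) i j i' j' i≤i' j≤j' (inj₂ unblocked) = inj₂ (unblocked ∘ blocked-antitone
      (≼-mono (λ {k} → young t k j k j' ≤-refl j≤j') (er j j' j≤j'))
      (≼-mono (λ {k} → young t i k i' k i≤i' ≤-refl) (ec i i' i≤i')))

    row-down : ∀ t j → DownClosed (λ k → A t k j)
    row-down t j m≤n = young t _ j _ j m≤n ≤-refl

    col-down : ∀ t i → DownClosed (λ k → A t i k)
    col-down t i m≤n = young t i _ i _ ≤-refl m≤n

    -- Membership in A_t is decidable, since T_en only counts down-closed sets.
    A? : ∀ t i j → Dec (A t i j)
    A? zero    i j = no λ ()
    A? (suc t) i j with A? t i j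
    ... | yes old = yes (inj₁ old)
    ... | no  new with Any.any? (λ ab →
                ¬? (atLeast? (row-down t j) (λ k → A? t k j) (proj₁ ab ∸ r j))
          ×-dec ¬? (atLeast? (col-down t i) (λ k → A? t i k) (proj₂ ab ∸ c i))) I
    ...   | yes blocked   = no λ { (inj₁ old) → new old ; (inj₂ unblocked) → unblocked blocked }
    ...   | no  unblocked = yes (inj₂ unblocked)

    left⇒row : ∀ t i j → LeftInClosure (A t) i j → AtLeast i (λ k → A t k j)
    left⇒row t zero    j _    = atLeast-zero {RowSet (A t) zero j}
    left⇒row t (suc i) j left = ∈⇒atLeast-suc (row-down t j) left

    below⇒col : ∀ t i j → BelowInClosure (A t) i j → AtLeast j (λ k → A t i k)
    below⇒col t i zero    _     = atLeast-zero {ColSet (A t) i zero}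
    below⇒col t i (suc j) below = ∈⇒atLeast-suc (col-down t i) below

    -- Property (2): a point whose closed neighbours are present is added at the
    -- next step; otherwise it is never added, contradicting spanning.
    closure-step : Spans I r c → ∀ t i j →
      LeftInClosure (A t) i j → BelowInClosure (A t) i j → A (suc t) i j
    closure-step spans t i j left below with A? t i j
    ... | yes old = inj₁ old
    ... | no  new = inj₂ λ blocked → never-added blocked (proj₁ (spans i j)) (proj₂ (spans i j))
      where
      never-added : Blocked t i j → ∀ u → ¬ A u i j
      never-added blocked zero    ()
      never-added blocked (suc u) (inj₁ old)       = never-added blocked u old
      never-added blocked (suc u) (inj₂ unblocked) = unblocked (blocked-antitone
        (≼-bounded (row-down u j) (never-added blocked u) (left⇒row t i j left))
        (≼-bounded (col-down u i) (never-added blocked u) (below⇒col t i j below)) blocked)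

lemma2p3 : (I : List (ℕ × ℕ)) → IsIndexSet I →
    (r c : ℕ → ℕ) → Enhancement r → Enhancement c → Spans I r c →
    (t : ℕ) →
      YoungDiagram (Aₜ I r c t)
      × (∀ i j → LeftInClosure (Aₜ I r c t) i j → BelowInClosure (Aₜ I r c t) i j →
           Aₜ I r c (suc t) i j)
      × (∀ i i' j j' → c i ≡ c i' → r j ≡ r j' →
           (Aₜ I r c t i j → Aₜ I r c t i' j') × (Aₜ I r c t i' j' → Aₜ I r c t i j))
-- The positivity of the index set is not needed: the argument only uses that 𝒵 is a down-set.
lemma2p3 I _ r c er ec spans t =
    young er ec t
  , closure-step er ec spans t
  , λ i i' j j' ci cj → symmetric t i i' j j' ci cj , symmetric t i' i j' j (sym ci) (sym cj)
  where open Bootstrap I r c
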